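{- Let $D$ be a Dyck path of size $n$. Label the up-steps of $D$ from $1$ to $n$ from left to right. For each up-step $a$, if there is an up-step after the matching down-step of $a$, let $b$ be the first such up-step and add the directed edge $a\to b$. Then the resulting directed graph is the Hasse diagram of the initial forest $\mathrm{inc}(\mathrm{tree}(D))$, i.e. of the poset on $\{1,\dots,n\}$ with $a\triangleleft b$ iff $v_a$ lies in the left subtree of $v_b$ in $\mathrm{tree}(D)$.
   Context: A Dyck path of size $n$ is a word in $\{1,0\}$ ($1$ = up-step, $0$ = down-step) with $n$ of each letter, every prefix having at least as many $1$'s as $0$'s; the matching down-step of an up-step is the first down-step after it returning to the up-step's starting height. $\mathrm{tree}(\text{empty})=\emptyset$ and, writing $D=D_1\,1\,D_2\,0$ uniquely with $D_1,D_2$ Dyck paths, $\mathrm{tree}(D)$ has left subtree $\mathrm{tree}(D_1)$ and right subtree $\mathrm{tree}(D_2)$. Nodes of a binary tree are $v_1,\dots,v_n$ in in-order (left subtree, root, right subtree). -}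

module Defs where

open import Data.Bool using (Bool; true; false)
open import Data.Nat using (ℕ; zero; suc; _+_; _≤_; _<_)
open import Data.List using (List; []; _∷_; _++_; take)
open import Data.Maybe using (Maybe; just; nothing)
open import Data.Product using (Σ; ∃; _×_; _,_)
open import Relation.Binary.PropositionalEquality using (_≡_; _≢_)
open import Relation.Nullary using (¬_)

-- Dyck words: true = up-step (1), false = down-step (0)

ups : List Bool → ℕ
ups [] = 0
ups (true ∷ w) = suc (ups w)
ups (false ∷ w) = ups w

downs : List Bool → ℕ
downs [] = 0
downs (true ∷ w) = downs w
downs (false ∷ w) = suc (downs w)

IsDyck : ℕ → List Bool → Set
IsDyck n D = ups D ≡ n × downs D ≡ n × (∀ i → downs (take i D) ≤ ups (take i D))

IsDyckAny : List Bool → Set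
IsDyckAny D = ∃ λ n → IsDyck n D

-- i-th letter (0-based positions)
nth : List Bool → ℕ → Maybe Bool
nth [] _ = nothing
nth (x ∷ w) zero = just x
nth (x ∷ w) (suc i) = nth w i

-- height after prefix of length m equals height after prefix of length p
SameHeight : List Bool → ℕ → ℕ → Set
SameHeight D p m = ups (take m D) + downs (take p D) ≡ ups (take p D) + downs (take m D)

-- the letter at position p is an up-step, and it is the a-th up-step (labels 1..n)
UpLabel : List Bool → ℕ → ℕ → Set
UpLabel D p a = nth D p ≡ just true × ups (take (suc p) D) ≡ a

-- the down-step at position q is the matching down-step of the up-step at position p:
-- first down-step after p returning to the starting height of p
Matching : List Bool → ℕ → ℕ → Set
Matching D p q =
  p < q × nth D q ≡ just false × SameHeight D p (suc q) ×
  (∀ r → p < r → r < q → nth D r ≡ just false → ¬ SameHeight D p (suc r))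

Edge : List Bool → ℕ → ℕ → Set
Edge D a b = Σ ℕ λ p → Σ ℕ λ q → Σ ℕ λ r →
  UpLabel D p a × Matching D p q × q < r × UpLabel D r b ×
  (∀ s → q < s → s < r → nth D s ≢ just true)

data Tree : Set where
  leaf : Tree
  node : Tree → Tree → Tree

size : Tree → ℕ
size leaf = 0
size (node l r) = suc (size l + size r)

data TreeOf : List Bool → Tree → Set where
  empty : TreeOf [] leaf
  split : ∀ {D₁ D₂ t₁ t₂} → IsDyckAny D₁ → IsDyckAny D₂ →
          TreeOf D₁ t₁ → TreeOf D₂ t₂ →
          TreeOf (D₁ ++ true ∷ D₂ ++ false ∷ []) (node t₁ t₂)

-- Nodes numbered 1..size t in in-order.
-- InLeft t a b : v_a lies in the left subtree of v_b  (a ◁ b)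
data InLeft : Tree → ℕ → ℕ → Set where
  here : ∀ {l r a} → 1 ≤ a → a ≤ size l → InLeft (node l r) a (suc (size l))
  inL  : ∀ {l r a b} → InLeft l a b → InLeft (node l r) a b
  inR  : ∀ {l r a b} → InLeft r a b →
         InLeft (node l r) (suc (size l) + a) (suc (size l) + b)

Covers : Tree → ℕ → ℕ → Set
Covers t a b = InLeft t a b × ¬ (∃ λ c → InLeft t a c × InLeft t c b)

module Submission where

-- Both relations decompose in the same way along D = X 1 Y 0, tree(D) = node tree(X)
-- tree(Y), described by  Glue R S M k : R on the labels 1..k, S shifted past a new label
-- k+1, and a → k+1 for the labels a satisfying M.
--  * Dyck side (module Decomposition): the edges of X 1 Y 0 are those of X, the shifted ones
--    of Y, and a → k+1 for the labels a of X without an edge in X, where k = ups X.  This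
--    rests on locality of edges under prefixes and suffixes and on existence and uniqueness
--    of matching down-steps in Dyck paths.
--  * Tree side (covers-node): the covers of node l r are those of l, the shifted ones of r,
--    and a → root for the maximal elements a of l.
-- As "no cover above" means "maximal" in a finite poset, induction on tree(D) identifies
-- edges with covers (edges-are-covers).  The tree itself exists because a left-to-right
-- parse of D with a stack of completed Dyck factors ends with a single factor (tree-exists).

open import Defs
open import Data.Bool using (Bool; true; false)
open import Data.Nat using (ℕ; zero; suc; _+_; _≤_; _<_; z≤n; s≤s)
open import Data.Nat.Properties
open import Data.List using (List; []; _∷_; _++_; take; length)
open import Data.List.Properties using (++-assoc; ++-identityʳ; take-all; take-[])
open import Data.Maybe using (just; nothing)
open import Data.Maybe.Properties using (≡-dec)
import Data.Bool
open import Data.Product using (Σ; ∃; ∃₂; _×_; _,_; proj₁; proj₂; map₁; map₂)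
open import Data.Sum using (_⊎_; inj₁; inj₂; [_,_]′)
open import Data.Empty using (⊥-elim)
open import Function.Base using (_∘_)
open import Function.Bundles using (_⇔_; mk⇔; Equivalence)
import Function.Properties.Equivalence as ⇔
open import Relation.Binary.PropositionalEquality
open import Relation.Binary.Definitions using (tri<; tri≈; tri>)
open import Relation.Nullary using (¬_; yes; no; contradiction)
open import Relation.Nullary.Decidable using (_×-dec_)
open import Relation.Unary using (Decidable)
import Relation.Binary.Reasoning.Setoid as SetoidReasoning
open import Level using (0ℓ)

module _ {P : ℕ → Set} (P? : Decidable P) where

  Least : ℕ → Set
  Least m = P m × (∀ k → k < m → ¬ P k)

  least : ∀ n → P n → ∃ λ m → m ≤ n × Least m
  least n = below (suc n) n ≤-refl
    where
    below : ∀ b n → n < b → P n → ∃ λ m → m ≤ n × Least m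
    below (suc b) n (s≤s n≤b) pn with anyUpTo? P? n
    ... | no none = n , ≤-refl , pn , λ k k<n pk → none (k , k<n , pk)
    ... | yes (k , k<n , pk) with below b k (≤-trans k<n n≤b) pk
    ...   | m , m≤k , least-m = m , ≤-trans m≤k (<⇒≤ k<n) , least-m

upsTo downsTo : List Bool → ℕ → ℕ
upsTo D m = ups (take m D)
downsTo D m = downs (take m D)

step-up : ∀ D m → nth D m ≡ just true →
  upsTo D (suc m) ≡ suc (upsTo D m) × downsTo D (suc m) ≡ downsTo D m
step-up (true ∷ D) zero refl = refl , refl
step-up (true ∷ D) (suc m) e = map₁ (cong suc) (step-up D m e)
step-up (false ∷ D) (suc m) e = map₂ (cong suc) (step-up D m e)

step-down : ∀ D m → nth D m ≡ just false →
  upsTo D (suc m) ≡ upsTo D m × downsTo D (suc m) ≡ suc (downsTo D m)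
step-down (false ∷ D) zero refl = refl , refl
step-down (true ∷ D) (suc m) e = map₁ (cong suc) (step-down D m e)
step-down (false ∷ D) (suc m) e = map₂ (cong suc) (step-down D m e)

step-end : ∀ D m → nth D m ≡ nothing →
  upsTo D (suc m) ≡ upsTo D m × downsTo D (suc m) ≡ downsTo D m
step-end [] m e = cong ups (sym (take-[] m)) , cong downs (sym (take-[] m))
step-end (true ∷ D) (suc m) e = map₁ (cong suc) (step-end D m e)
step-end (false ∷ D) (suc m) e = map₂ (cong suc) (step-end D m e)

upsTo-mono : ∀ D {m n} → m ≤ n → upsTo D m ≤ upsTo D n
upsTo-mono D {zero} _ = z≤n
upsTo-mono [] {suc m} _ = z≤n
upsTo-mono (true ∷ D) {suc m} (s≤s le) = s≤s (upsTo-mono D le)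
upsTo-mono (false ∷ D) {suc m} (s≤s le) = upsTo-mono D le

ups-++ : ∀ (X Z : List Bool) → ups (X ++ Z) ≡ ups X + ups Z
ups-++ [] Z = refl
ups-++ (true ∷ X) Z = cong suc (ups-++ X Z)
ups-++ (false ∷ X) Z = ups-++ X Z

downs-++ : ∀ (X Z : List Bool) → downs (X ++ Z) ≡ downs X + downs Z
downs-++ [] Z = refl
downs-++ (true ∷ X) Z = downs-++ X Z
downs-++ (false ∷ X) Z = cong suc (downs-++ X Z)

nth-++ˡ : ∀ (X Z : List Bool) {i} → i < length X → nth (X ++ Z) i ≡ nth X i
nth-++ˡ (x ∷ X) Z {zero} _ = refl
nth-++ˡ (x ∷ X) Z {suc i} (s≤s i<L) = nth-++ˡ X Z i<L

nth-++ʳ : ∀ (X Z : List Bool) i → nth (X ++ Z) (length X + i) ≡ nth Z i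
nth-++ʳ [] Z i = refl
nth-++ʳ (x ∷ X) Z i = nth-++ʳ X Z i

take-++ˡ : ∀ (X Z : List Bool) {m} → m ≤ length X → take m (X ++ Z) ≡ take m X
take-++ˡ X Z {zero} _ = refl
take-++ˡ (x ∷ X) Z {suc m} (s≤s m≤L) = cong (x ∷_) (take-++ˡ X Z m≤L)

upsTo-++ʳ : ∀ (X Z : List Bool) m → upsTo (X ++ Z) (length X + m) ≡ ups X + upsTo Z m
upsTo-++ʳ [] Z m = refl
upsTo-++ʳ (true ∷ X) Z m = cong suc (upsTo-++ʳ X Z m)
upsTo-++ʳ (false ∷ X) Z m = upsTo-++ʳ X Z m

nth-inside : ∀ (X : List Bool) i {y} → nth X i ≡ just y → i < length X
nth-inside (x ∷ X) zero _ = s≤s z≤n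
nth-inside (x ∷ X) (suc i) e = s≤s (nth-inside X i e)

offset : ∀ {L m} → L ≤ m → ∃ λ k → m ≡ L + k
offset L≤m = let k , e = m≤n⇒∃[o]m+o≡n L≤m in k , sym e

-- The walk of w started at height h never goes below height 0.  The prefix condition of
-- IsDyck is (definitionally) Valid 0.
Valid : ℕ → List Bool → Set
Valid h w = ∀ i → downsTo w i ≤ h + upsTo w i

valid-[] : ∀ h → Valid h []
valid-[] h zero = z≤n
valid-[] h (suc i) = z≤n

valid-up : ∀ {h w} → Valid (suc h) w → Valid h (true ∷ w)
valid-up valid zero = z≤n
valid-up {h} valid (suc i) = ≤-trans (valid i) (≤-reflexive (sym (+-suc h _)))

valid-up⁻¹ : ∀ {h w} → Valid h (true ∷ w) → Valid (suc h) w
valid-up⁻¹ {h} valid i = ≤-trans (valid (suc i)) (≤-reflexive (+-suc h _))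

valid-down : ∀ {h w} → Valid h w → Valid (suc h) (false ∷ w)
valid-down valid zero = z≤n
valid-down valid (suc i) = s≤s (valid i)

valid-down⁻¹ : ∀ {h w} → Valid (suc h) (false ∷ w) → Valid h w
valid-down⁻¹ valid i = ≤-pred (valid (suc i))

no-descent-from-0 : ∀ {w} → ¬ Valid 0 (false ∷ w)
no-descent-from-0 valid = contradiction (valid 1) λ ()

valid-raise : ∀ {h w} → Valid h w → Valid (suc h) w
valid-raise valid i = m≤n⇒m≤1+n (valid i)

valid-++ : ∀ {h h'} X {Z} → Valid h X → Valid h' Z → h' + downs X ≡ h + ups X → Valid h (X ++ Z)
valid-++ [] valid-X valid-Z e =
  subst (λ h → Valid h _) (trans (sym (+-identityʳ _)) (trans e (+-identityʳ _))) valid-Z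
valid-++ {h} (true ∷ X) valid-X valid-Z e =
  valid-up (valid-++ X (valid-up⁻¹ valid-X) valid-Z (trans e (+-suc h _)))
valid-++ {zero} (false ∷ X) valid-X _ _ = contradiction valid-X no-descent-from-0
valid-++ {suc h} {h'} (false ∷ X) valid-X valid-Z e =
  valid-down (valid-++ X (valid-down⁻¹ valid-X) valid-Z (suc-injective (trans (sym (+-suc h' _)) e)))

crossing-step : ∀ X p q →
  upsTo X p + downsTo X q < upsTo X q + downsTo X p →
  upsTo X (suc q) + downsTo X p ≤ upsTo X p + downsTo X (suc q) →
  nth X q ≡ just false × SameHeight X p (suc q)
crossing-step X p q above back with nth X q in eq
... | just true rewrite proj₁ (step-up X q eq) | proj₂ (step-up X q eq) =
  contradiction (≤-trans (n≤1+n _) back) (<⇒≱ above)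
... | nothing rewrite proj₁ (step-end X q eq) | proj₂ (step-end X q eq) =
  contradiction back (<⇒≱ above)
... | just false rewrite proj₁ (step-down X q eq) | proj₂ (step-down X q eq) =
  refl , ≤-antisym back (≤-trans (≤-reflexive (+-suc _ _)) above)

-- In a Dyck path every up-step has a matching down-step: the first position after it at
-- which the walk is back at its starting height.
matching-exists : ∀ X → IsDyckAny X → ∀ p → nth X p ≡ just true → ∃ (Matching X p)
matching-exists X (_ , ups≡n , downs≡n , valid) p up = first-return (least Returns? L returns-at-end)
  where
  L : ℕ
  L = length X
  Returns : ℕ → Set
  Returns m = p < m × upsTo X m + downsTo X p ≤ upsTo X p + downsTo X m
  Returns? : Decidable Returns
  Returns? m = (p <? m) ×-dec (upsTo X m + downsTo X p ≤? upsTo X p + downsTo X m)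

  whole : take L X ≡ X
  whole = take-all L X ≤-refl
  returns-at-end : Returns L
  returns-at-end = nth-inside X p up , (begin
    upsTo X L + downsTo X p ≡⟨ cong (λ w → ups w + downsTo X p) whole ⟩
    ups X + downsTo X p     ≤⟨ +-monoʳ-≤ (ups X) (valid p) ⟩
    ups X + upsTo X p       ≡⟨ +-comm (ups X) _ ⟩
    upsTo X p + ups X       ≡⟨ cong (upsTo X p +_) (trans ups≡n (sym downs≡n)) ⟩
    upsTo X p + downs X     ≡⟨ cong (λ w → upsTo X p + downs w) (sym whole) ⟩
    upsTo X p + downsTo X L ∎)
    where open ≤-Reasoning

  first-return : (∃ λ m → m ≤ L × Least Returns? m) → ∃ (Matching X p)
  first-return (zero , _ , (() , _) , _)
  first-return (suc q , _ , (p<sq , back) , earlier) with m≤n⇒m<n∨m≡n (≤-pred p<sq)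
  ... | inj₂ refl rewrite proj₁ (step-up X p up) | proj₂ (step-up X p up) =
    contradiction back (<-irrefl refl)
  ... | inj₁ p<q = q , p<q , proj₁ crossing , proj₂ crossing , no-earlier-return
    where
    above : upsTo X p + downsTo X q < upsTo X q + downsTo X p
    above = ≰⇒> λ below → earlier q ≤-refl (p<q , below)
    crossing : nth X q ≡ just false × SameHeight X p (suc q)
    crossing = crossing-step X p q above back
    no-earlier-return : ∀ r → p < r → r < q → nth X r ≡ just false → ¬ SameHeight X p (suc r)
    no-earlier-return r p<r r<q _ same = earlier (suc r) (s≤s r<q) (m<n⇒m<1+n p<r , ≤-reflexive same)

-- Every label 1..ups X is carried by some up-step: the first prefix containing a up-steps
-- ends with one.
label-exists : ∀ X a → 1 ≤ a → a ≤ ups X → ∃ λ p → UpLabel X p a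
label-exists X a 1≤a a≤ups = last-step (least (λ m → a ≤? upsTo X m) (length X) reached)
  where
  reached : a ≤ upsTo X (length X)
  reached = subst (λ w → a ≤ ups w) (sym (take-all (length X) X ≤-refl)) a≤ups
  last-step : (∃ λ m → m ≤ length X × Least (λ m → a ≤? upsTo X m) m) → ∃ λ p → UpLabel X p a
  last-step (zero , _ , a≤0 , _) = contradiction (≤-trans 1≤a a≤0) λ ()
  last-step (suc p , _ , a≤ , earlier) with nth X p in eq
  ... | just true = p , eq , ≤-antisym (≤-trans (≤-reflexive (proj₁ (step-up X p eq))) before) a≤
    where
    before : upsTo X p < a
    before = ≰⇒> (earlier p ≤-refl)
  ... | just false = contradiction (subst (a ≤_) (proj₁ (step-down X p eq)) a≤) (earlier p ≤-refl)
  ... | nothing = contradiction (subst (a ≤_) (proj₁ (step-end X p eq)) a≤) (earlier p ≤-refl)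

labels-increase : ∀ X {p p' a a'} → UpLabel X p a → UpLabel X p' a' → p < p' → a < a'
labels-increase X {p} {p'} (_ , refl) (up' , refl) p<p' = begin-strict
  upsTo X (suc p)        ≤⟨ upsTo-mono X p<p' ⟩
  upsTo X p'             <⟨ n<1+n _ ⟩
  suc (upsTo X p')       ≡⟨ sym (proj₁ (step-up X p' up')) ⟩
  upsTo X (suc p')       ∎
  where open ≤-Reasoning

label-unique : ∀ X {p p' a} → UpLabel X p a → UpLabel X p' a → p ≡ p'
label-unique X {p} {p'} lp lp' with <-cmp p p'
... | tri< p<p' _ _ = contradiction (labels-increase X lp lp' p<p') (<-irrefl refl)
... | tri≈ _ p≡p' _ = p≡p'
... | tri> _ _ p'<p = contradiction (labels-increase X lp' lp p'<p) (<-irrefl refl)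

-- The matching down-step is unique: two candidates would violate each other's minimality.
matching-unique : ∀ X {p q q'} → Matching X p q → Matching X p q' → q ≡ q'
matching-unique X {q = q} {q'} (p<q , down , same , first) (p<q' , down' , same' , first') with <-cmp q q'
... | tri< q<q' _ _ = contradiction same (first' q p<q q<q' down)
... | tri≈ _ q≡q' _ = q≡q'
... | tri> _ _ q'<q = contradiction same' (first q' p<q' q'<q down')

EdgeAt : List Bool → ℕ → ℕ → ℕ → ℕ → ℕ → Set
EdgeAt D a b p q r = UpLabel D p a × Matching D p q × q < r × UpLabel D r b ×
  (∀ s → q < s → s < r → nth D s ≢ just true)

target-up : ∀ {D a b p q r} → EdgeAt D a b p q r → nth D r ≡ just true
target-up (_ , _ , _ , (up , _) , _) = up

edge-inside : ∀ X {a b p q r} → EdgeAt X a b p q r → r < length X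
edge-inside X E = nth-inside X _ (target-up E)

matching-transport : ∀ {D E p q} →
  (∀ r → r ≤ q → nth D r ≡ nth E r) →
  (p < q → ∀ m → m ≤ suc q → SameHeight D p m ⇔ SameHeight E p m) →
  Matching D p q → Matching E p q
matching-transport letters heights (p<q , down , same , first) =
  p<q , trans (sym (letters _ ≤-refl)) down , Equivalence.to (heights p<q _ ≤-refl) same ,
  λ r p<r r<q down-r same-r →
    first r p<r r<q (trans (letters r (<⇒≤ r<q)) down-r)
      (Equivalence.from (heights p<q (suc r) (m≤n⇒m≤1+n r<q)) same-r)

module _ (X Z : List Bool) where

  label-prefix : ∀ {p a} → p < length X → UpLabel (X ++ Z) p a ⇔ UpLabel X p a
  label-prefix p<L rewrite nth-++ˡ X Z p<L | take-++ˡ X Z p<L = ⇔.refl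

  height-prefix : ∀ {p m} → p ≤ length X → m ≤ length X →
    SameHeight (X ++ Z) p m ⇔ SameHeight X p m
  height-prefix p≤L m≤L rewrite take-++ˡ X Z p≤L | take-++ˡ X Z m≤L = ⇔.refl

  matching-prefix : ∀ {p q} → q < length X → Matching (X ++ Z) p q ⇔ Matching X p q
  matching-prefix {p} {q} q<L = mk⇔
    (matching-transport letters heights)
    (matching-transport (λ r r≤q → sym (letters r r≤q)) λ p<q m m≤ → ⇔.sym (heights p<q m m≤))
    where
    letters : ∀ r → r ≤ q → nth (X ++ Z) r ≡ nth X r
    letters r r≤q = nth-++ˡ X Z (≤-<-trans r≤q q<L)
    heights : p < q → ∀ m → m ≤ suc q → SameHeight (X ++ Z) p m ⇔ SameHeight X p m
    heights p<q m m≤ = height-prefix (<⇒≤ (<-trans p<q q<L)) (≤-trans m≤ q<L)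

  edge-prefix : ∀ {a b p q r} → r < length X → EdgeAt (X ++ Z) a b p q r ⇔ EdgeAt X a b p q r
  edge-prefix {a} {b} {p} {q} {r} r<L = mk⇔
    (λ (lp , m , q<r , lr , gap) →
       to (label-prefix (p<L m q<r)) lp , to (matching-prefix (q<L q<r)) m , q<r ,
       to (label-prefix r<L) lr , λ s q<s s<r → gap s q<s s<r ∘ trans (letters s<r))
    (λ (lp , m , q<r , lr , gap) →
       from (label-prefix (p<L m q<r)) lp , from (matching-prefix (q<L q<r)) m , q<r ,
       from (label-prefix r<L) lr , λ s q<s s<r → gap s q<s s<r ∘ trans (sym (letters s<r)))
    where
    open Equivalence
    q<L : q < r → q < length X
    q<L q<r = <-trans q<r r<L
    p<L : ∀ {Y} → Matching Y p q → q < r → p < length X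
    p<L (p<q , _) q<r = <-trans p<q (q<L q<r)
    letters : ∀ {s} → s < r → nth (X ++ Z) s ≡ nth X s
    letters s<r = nth-++ˡ X Z (<-trans s<r r<L)

+-suc-cancel : ∀ {a b c d} → a + suc b ≡ c + suc d ⇔ a + b ≡ c + d
+-suc-cancel {a} {b} {c} {d} = mk⇔
  (λ e → suc-injective (trans (sym (+-suc a b)) (trans e (+-suc c d))))
  (λ e → trans (+-suc a b) (trans (cong suc e) (sym (+-suc c d))))

height-cons : ∀ x W {p m} → SameHeight (x ∷ W) (suc p) (suc m) ⇔ SameHeight W p m
height-cons true W = mk⇔ suc-injective (cong suc)
height-cons false W = +-suc-cancel

label-cons : ∀ x W {p a} → UpLabel (x ∷ W) (suc p) (ups (x ∷ []) + a) ⇔ UpLabel W p a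
label-cons true W = mk⇔ (map₂ suc-injective) (map₂ (cong suc))
label-cons false W = ⇔.refl

matching-cons : ∀ x W {p q} → Matching (x ∷ W) (suc p) (suc q) ⇔ Matching W p q
matching-cons x W = mk⇔
  (λ { (s≤s p<q , down , same , first) → p<q , down , to (height-cons x W) same ,
     λ r p<r r<q down-r same-r →
       first (suc r) (s≤s p<r) (s≤s r<q) down-r (from (height-cons x W) same-r) })
  (λ (p<q , down , same , first) → s≤s p<q , down , from (height-cons x W) same ,
     λ { (suc r) (s≤s p<r) (s≤s r<q) down-r same-r →
           first r p<r r<q down-r (to (height-cons x W) same-r) })
  where open Equivalence

edge-cons : ∀ x W {a b p q r} →
  EdgeAt (x ∷ W) (ups (x ∷ []) + a) (ups (x ∷ []) + b) (suc p) (suc q) (suc r) ⇔ EdgeAt W a b p q r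
edge-cons x W = mk⇔
  (λ { (lp , m , s≤s q<r , lr , gap) →
     to (label-cons x W) lp , to (matching-cons x W) m , q<r , to (label-cons x W) lr ,
     λ s q<s s<r → gap (suc s) (s≤s q<s) (s≤s s<r) })
  (λ (lp , m , q<r , lr , gap) →
     from (label-cons x W) lp , from (matching-cons x W) m , s≤s q<r , from (label-cons x W) lr ,
     λ { (suc s) (s≤s q<s) (s≤s s<r) → gap s q<s s<r })
  where open Equivalence

edge-shift : ∀ X Z {a b p q r} →
  EdgeAt (X ++ Z) (ups X + a) (ups X + b) (length X + p) (length X + q) (length X + r) ⇔
  EdgeAt Z a b p q r
edge-shift [] Z = ⇔.refl
edge-shift (true ∷ X) Z = ⇔.trans (edge-cons true (X ++ Z)) (edge-shift X Z)
edge-shift (false ∷ X) Z = ⇔.trans (edge-cons false (X ++ Z)) (edge-shift X Z)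

edge-beyond : ∀ X Z {a b p q r} → length X ≤ p → EdgeAt (X ++ Z) a b p q r →
  ∃₂ λ a' b' → a ≡ ups X + a' × b ≡ ups X + b' × Edge Z a' b'
edge-beyond X Z {p = p} {q} {r} L≤p E@((_ , refl) , (p<q , _) , q<r , (_ , refl) , _)
  with p' , refl ← offset L≤p
     | q' , refl ← offset (≤-trans L≤p (<⇒≤ p<q))
     | r' , refl ← offset (≤-trans L≤p (<⇒≤ (<-trans p<q q<r))) =
  upsTo Z (suc p') , upsTo Z (suc r') , label-offset p' , label-offset r' , p' , q' , r' ,
  Equivalence.to (edge-shift X Z)
    (subst₂ (λ a b → EdgeAt (X ++ Z) a b _ _ _) (label-offset p') (label-offset r') E)
  where
  label-offset : ∀ m → upsTo (X ++ Z) (suc (length X + m)) ≡ ups X + upsTo Z (suc m)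
  label-offset m = trans (cong (upsTo (X ++ Z)) (sym (+-suc (length X) m))) (upsTo-++ʳ X Z (suc m))

Maximal : (ℕ → ℕ → Set) → ℕ → ℕ → Set
Maximal R k a = (1 ≤ a × a ≤ k) × ¬ (∃ λ c → R a c)

-- Glue R S M k relates labels 1..k by R, labels k+2.. by S shifted by k+1, and sends the
-- labels satisfying M to the new label k+1.  Both the edges of a Dyck path D₁ 1 D₂ 0 and
-- the covering relation of a tree node l r decompose in this way.
data Glue (R S : ℕ → ℕ → Set) (M : ℕ → Set) (k : ℕ) : ℕ → ℕ → Set where
  left  : ∀ {a b} → R a b → Glue R S M k a b
  root  : ∀ {a} → M a → Glue R S M k a (suc k)
  right : ∀ {a b} → S a b → Glue R S M k (suc k + a) (suc k + b)

glue-map : ∀ {R R' S S' : ℕ → ℕ → Set} {M M' : ℕ → Set} {k a b} →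
  (∀ {a b} → R a b → R' a b) → (∀ {a b} → S a b → S' a b) → (∀ {a} → M a → M' a) →
  Glue R S M k a b → Glue R' S' M' k a b
glue-map f g h (left x) = left (f x)
glue-map f g h (root x) = root (h x)
glue-map f g h (right x) = right (g x)

glue-cong : ∀ {R R' S S' : ℕ → ℕ → Set} {M M' : ℕ → Set} {k} →
  (∀ a b → R a b ⇔ R' a b) → (∀ a b → S a b ⇔ S' a b) → (∀ a → M a ⇔ M' a) →
  ∀ a b → Glue R S M k a b ⇔ Glue R' S' M' k a b
glue-cong R⇔ S⇔ M⇔ a b = mk⇔
  (glue-map (to (R⇔ _ _)) (to (S⇔ _ _)) (to (M⇔ _)))
  (glue-map (from (R⇔ _ _)) (from (S⇔ _ _)) (from (M⇔ _)))
  where open Equivalence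

maximal-cong : ∀ {R R' : ℕ → ℕ → Set} {k} → (∀ a c → R a c ⇔ R' a c) →
  ∀ a → Maximal R k a ⇔ Maximal R' k a
maximal-cong R⇔ a = mk⇔
  (λ (bounds , none) → bounds , λ (c , x) → none (c , from (R⇔ a c) x))
  (λ (bounds , none) → bounds , λ (c , x) → none (c , to (R⇔ a c) x))
  where open Equivalence

up-in-prefix : ∀ Y k → nth (Y ++ false ∷ []) k ≡ just true → k < length Y
up-in-prefix [] zero ()
up-in-prefix [] (suc k) ()
up-in-prefix (y ∷ Y) zero _ = s≤s z≤n
up-in-prefix (y ∷ Y) (suc k) up = s≤s (up-in-prefix Y k up)

-- In 1 Y 0 with Y a Dyck path, the first up-step is matched by the last step, so no edge
-- starts at it.
no-edge-from-first : ∀ Y → IsDyckAny Y → ∀ {a b q r} → ¬ EdgeAt (true ∷ Y ++ false ∷ []) a b 0 q r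
no-edge-from-first Y (_ , _ , _ , valid) {q = suc j} {suc k}
                   (_ , (_ , _ , same , _) , s≤s j<k , (up , _) , _) =
  contradiction (valid (suc j)) (<⇒≱ below-zero)
  where
  inside : take (suc j) (Y ++ false ∷ []) ≡ take (suc j) Y
  inside = take-++ˡ Y (false ∷ []) (<-trans j<k (up-in-prefix Y k up))
  below-zero : upsTo Y (suc j) < downsTo Y (suc j)
  below-zero = ≤-reflexive (trans (sym (+-identityʳ _))
    (subst (λ w → suc (ups w) + 0 ≡ downs w) inside same))

module Decomposition (X Y : List Bool) (dyck-X : IsDyckAny X) (dyck-Y : IsDyckAny Y) where
  W D : List Bool
  W = Y ++ false ∷ []
  D = X ++ true ∷ W
  L k : ℕ
  L = length X
  k = ups X

  root-label : UpLabel D L (suc k)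
  root-label =
    subst (λ i → nth D i ≡ just true) (+-identityʳ L) (nth-++ʳ X (true ∷ W) 0) ,
    trans (cong (upsTo D) (+-comm 1 L)) (trans (upsTo-++ʳ X (true ∷ W) 1) (+-comm k 1))

  matching-in-X : ∀ {p q} → nth X p ≡ just true → Matching D p q → Matching X p q
  matching-in-X {p} up m with q₀ , m₀ ← matching-exists X dyck-X p up =
    subst (Matching X p) (matching-unique D m₀-in-D m) m₀
    where
    m₀-in-D : Matching D p q₀
    m₀-in-D = Equivalence.from (matching-prefix X (true ∷ W) (nth-inside X q₀ (proj₁ (proj₂ m₀)))) m₀

  label-bounds : ∀ {p a} → UpLabel X p a → 1 ≤ a × a ≤ k
  label-bounds {p} (up , refl) =
    subst (1 ≤_) (sym (proj₁ (step-up X p up))) (s≤s z≤n) ,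
    subst (λ w → upsTo X (suc p) ≤ ups w) (take-all L X ≤-refl) (upsTo-mono X (nth-inside X p up))

  -- An edge of D from an up-step of X either stays in X or ends at the new up-step; in
  -- the latter case its source has no edge in X, as that edge would end before L.
  edge-from-X : ∀ {a b p q r} → p < L → EdgeAt D a b p q r →
    Glue (Edge X) (Edge Y) (Maximal (Edge X) k) k a b
  edge-from-X {a} {b} {p} {q} {r} p<L E@(lp , m , q<r , lr , gap) = ends (m≤n⇒m<n∨m≡n r≤L)
    where
    lp-X : UpLabel X p a
    lp-X = Equivalence.to (label-prefix X (true ∷ W) p<L) lp
    m-X : Matching X p q
    m-X = matching-in-X (proj₁ lp-X) m
    q<L : q < L
    q<L = nth-inside X q (proj₁ (proj₂ m-X))
    r≤L : r ≤ L
    r≤L = ≮⇒≥ λ L<r → gap L q<L L<r (proj₁ root-label)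
    no-edge : r ≡ L → ¬ (∃ λ c → Edge X a c)
    no-edge r≡L (c , p₂ , q₂ , r₂ , lp₂ , m₂ , q₂<r₂ , (up₂ , _) , _) =
      gap r₂ (subst (_< r₂) q₂≡q q₂<r₂) (subst (r₂ <_) (sym r≡L) r₂<L)
        (trans (nth-++ˡ X (true ∷ W) r₂<L) up₂)
      where
      r₂<L : r₂ < L
      r₂<L = nth-inside X r₂ up₂
      q₂≡q : q₂ ≡ q
      q₂≡q = matching-unique X (subst (λ p → Matching X p q₂) (label-unique X lp₂ lp-X) m₂) m-X
    ends : r < L ⊎ r ≡ L → Glue (Edge X) (Edge Y) (Maximal (Edge X) k) k a b
    ends (inj₁ r<L) = left (p , q , r , Equivalence.to (edge-prefix X (true ∷ W) r<L) E)
    ends (inj₂ refl) = subst (Glue _ _ _ k a) (trans (sym (proj₂ root-label)) (proj₂ lr))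
                         (root (label-bounds lp-X , no-edge refl))

  -- An edge of D from the new up-step or beyond is a shifted edge of Y; the new up-step
  -- itself is matched by the last step and so starts no edge.
  edge-from-Y : ∀ {a b p q r} → L ≤ p → EdgeAt D a b p q r →
    Glue (Edge X) (Edge Y) (Maximal (Edge X) k) k a b
  edge-from-Y L≤p E with edge-beyond X (true ∷ W) L≤p E
  ... | _ , _ , _ , _ , zero , _ , _ , E-first = ⊥-elim (no-edge-from-first Y dyck-Y E-first)
  ... | _ , _ , refl , refl , suc p' , _ , _ , E-Z with edge-beyond (true ∷ []) W (s≤s z≤n) E-Z
  ...   | a , b , refl , refl , p , q , r , E-W =
    subst₂ (Glue _ _ _ k) (sym (+-suc k a)) (sym (+-suc k b))
      (right (p , q , r , Equivalence.to (edge-prefix Y (false ∷ []) r<|Y|) E-W))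
    where
    r<|Y| : r < length Y
    r<|Y| = up-in-prefix Y r (target-up E-W)

  edge-split→ : ∀ {a b} → Edge D a b → Glue (Edge X) (Edge Y) (Maximal (Edge X) k) k a b
  edge-split→ (p , q , r , E) with p <? L
  ... | yes p<L = edge-from-X p<L E
  ... | no p≮L = edge-from-Y (≮⇒≥ p≮L) E

  UpAfter : ℕ → ℕ → Set
  UpAfter q s = q < s × nth D s ≡ just true

  UpAfter? : ∀ q → Decidable (UpAfter q)
  UpAfter? q s = (q <? s) ×-dec ≡-dec Data.Bool._≟_ (nth D s) (just true)

  -- Conversely a label of X without an edge in X has an edge to the new up-step: the first
  -- up-step after its matching down-step cannot lie inside X.
  edge-to-root : ∀ {a} → Maximal (Edge X) k a → Edge D a (suc k)
  edge-to-root {a} ((1≤a , a≤k) , no-edge) with label-exists X a 1≤a a≤k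
  ... | p , lp with matching-exists X dyck-X p (proj₁ lp)
  ... | q , m with least (UpAfter? q) L (nth-inside X q (proj₁ (proj₂ m)) , proj₁ root-label)
  ... | r , r≤L , (q<r , up-r) , earlier = ends (m≤n⇒m<n∨m≡n r≤L)
    where
    E : EdgeAt D a (upsTo D (suc r)) p q r
    E = Equivalence.from (label-prefix X (true ∷ W) (nth-inside X p (proj₁ lp))) lp ,
        Equivalence.from (matching-prefix X (true ∷ W) (nth-inside X q (proj₁ (proj₂ m)))) m ,
        q<r , (up-r , refl) , λ s q<s s<r up-s → earlier s s<r (q<s , up-s)
    ends : r < L ⊎ r ≡ L → Edge D a (suc k)
    ends (inj₁ r<L) = ⊥-elim (no-edge (_ , p , q , r , Equivalence.to (edge-prefix X (true ∷ W) r<L) E))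
    ends (inj₂ refl) = p , q , r , subst (λ b → EdgeAt D a b p q r) (proj₂ root-label) E

  edge-split← : ∀ {a b} → Glue (Edge X) (Edge Y) (Maximal (Edge X) k) k a b → Edge D a b
  edge-split← (left (p , q , r , E)) =
    p , q , r , Equivalence.from (edge-prefix X (true ∷ W) (edge-inside X E)) E
  edge-split← (root maximal) = edge-to-root maximal
  edge-split← (right {a} {b} (p , q , r , E)) =
    L + suc p , L + suc q , L + suc r ,
    subst₂ (λ a b → EdgeAt D a b (L + suc p) (L + suc q) (L + suc r)) (+-suc k a) (+-suc k b)
      (Equivalence.from (edge-shift X (true ∷ W))
        (Equivalence.from (edge-cons true W)
          (Equivalence.from (edge-prefix Y (false ∷ []) (edge-inside Y E)) E)))

  edge-split : ∀ a b → Edge D a b ⇔ Glue (Edge X) (Edge Y) (Maximal (Edge X) k) k a b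
  edge-split a b = mk⇔ edge-split→ edge-split←

inLeft-bounds : ∀ {t a b} → InLeft t a b → 1 ≤ a × a < b × b ≤ size t
inLeft-bounds {node l r} (here 1≤a a≤l) = 1≤a , s≤s a≤l , s≤s (m≤m+n (size l) (size r))
inLeft-bounds {node l r} (inL a◁b) with 1≤a , a<b , b≤l ← inLeft-bounds a◁b =
  1≤a , a<b , m≤n⇒m≤1+n (≤-trans b≤l (m≤m+n (size l) (size r)))
inLeft-bounds {node l r} (inR a◁b) with _ , a<b , b≤r ← inLeft-bounds a◁b =
  s≤s z≤n , +-monoʳ-< (suc (size l)) a<b , s≤s (+-monoʳ-≤ (size l) b≤r)

inLeft-left : ∀ {l r a b} → InLeft (node l r) a b → b ≤ size l → InLeft l a b
inLeft-left (here _ _) b≤l = contradiction b≤l (<-irrefl refl)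
inLeft-left (inL a◁b) _ = a◁b
inLeft-left {l} (inR {b = b} _) b≤l = contradiction b≤l (<⇒≱ (s≤s (m≤m+n (size l) b)))

inLeft-right : ∀ {l r a c} → InLeft (node l r) (suc (size l) + a) c →
  ∃ λ c' → c ≡ suc (size l) + c' × InLeft r a c'
inLeft-right {l} {r} {a} a◁c = shifted a◁c refl
  where
  beyond-left : ∀ {a₀} → a₀ ≡ suc (size l) + a → ¬ a₀ ≤ size l
  beyond-left refl = <⇒≱ (s≤s (m≤m+n (size l) a))
  shifted : ∀ {a₀ c} → InLeft (node l r) a₀ c → a₀ ≡ suc (size l) + a →
    ∃ λ c' → c ≡ suc (size l) + c' × InLeft r a c'
  shifted (here _ a₀≤l) e = contradiction a₀≤l (beyond-left e)
  shifted (inL a₀◁c) e with _ , a₀<c , c≤l ← inLeft-bounds a₀◁c =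
    contradiction (≤-trans (<⇒≤ a₀<c) c≤l) (beyond-left e)
  shifted (inR {b = c'} a'◁c') e =
    c' , refl , subst (λ a' → InLeft r a' c') (+-cancelˡ-≡ (suc (size l)) _ _ e) a'◁c'

NodeGlue : Tree → Tree → ℕ → ℕ → Set
NodeGlue l r = Glue (Covers l) (Covers r) (Maximal (InLeft l) (size l)) (size l)

covers-node : ∀ l r a b → Covers (node l r) a b ⇔ NodeGlue l r a b
covers-node l r a b = mk⇔ to from
  where
  to : ∀ {a b} → Covers (node l r) a b → NodeGlue l r a b
  to (here 1≤a a≤l , none) = root ((1≤a , a≤l) , λ (c , a◁c) →
    let _ , a<c , c≤l = inLeft-bounds a◁c in none (c , inL a◁c , here (≤-trans 1≤a (<⇒≤ a<c)) c≤l))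
  to (inL a◁b , none) = left (a◁b , λ (c , a◁c , c◁b) → none (c , inL a◁c , inL c◁b))
  to (inR a◁b , none) = right (a◁b , λ (c , a◁c , c◁b) → none (suc (size l) + c , inR a◁c , inR c◁b))

  from : ∀ {a b} → NodeGlue l r a b → Covers (node l r) a b
  from (left (a◁b , none)) = inL a◁b , λ (c , a◁c , c◁b) →
    let _ , c<b , _ = inLeft-bounds c◁b ; _ , _ , b≤l = inLeft-bounds a◁b in
    none (c , inLeft-left a◁c (≤-trans (<⇒≤ c<b) b≤l) , inLeft-left c◁b b≤l)
  from (root ((1≤a , a≤l) , maximal)) = here 1≤a a≤l , λ (c , a◁c , c◁root) →
    maximal (c , inLeft-left a◁c (≤-pred (proj₁ (proj₂ (inLeft-bounds c◁root)))))
  from (right {a} {b} (a◁b , none)) = inR a◁b , λ (c , a◁c , c◁b) → shifted-cover a◁c c◁b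
    where
    shifted-cover : ∀ {c} → InLeft (node l r) (suc (size l) + a) c →
                    ¬ InLeft (node l r) c (suc (size l) + b)
    shifted-cover a◁c c◁b with c' , refl , a◁c' ← inLeft-right a◁c
                          with b' , e , c'◁b' ← inLeft-right c◁b =
      none (c' , a◁c' , subst (InLeft r c') (sym (+-cancelˡ-≡ (suc (size l)) _ _ e)) c'◁b')

cover-or-maximal : ∀ t a → (∃ λ c → Covers t a c) ⊎ ¬ (∃ λ c → InLeft t a c)
cover-or-maximal leaf a = inj₂ λ ()
cover-or-maximal (node l r) a with a ≤? size l
cover-or-maximal (node l r) zero | yes _ =
  inj₂ λ (c , 0◁c) → contradiction (proj₁ (inLeft-bounds 0◁c)) λ ()
cover-or-maximal (node l r) (suc a) | yes a<l with cover-or-maximal l (suc a)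
... | inj₁ (c , a⋖c) = inj₁ (c , Equivalence.from (covers-node l r _ c) (left a⋖c))
... | inj₂ maximal =
  inj₁ (suc (size l) , Equivalence.from (covers-node l r _ _) (root ((s≤s z≤n , a<l) , maximal)))
cover-or-maximal (node l r) a | no a≰l with a' , refl ← offset (≰⇒> a≰l) with cover-or-maximal r a'
... | inj₁ (c , a'⋖c) = inj₁ (suc (size l) + c , Equivalence.from (covers-node l r _ _) (right a'⋖c))
... | inj₂ maximal =
  inj₂ λ (c , a◁c) → let c' , _ , a'◁c' = inLeft-right a◁c in maximal (c' , a'◁c')

maximal-covers : ∀ t k a → Maximal (Covers t) k a ⇔ Maximal (InLeft t) k a
maximal-covers t k a = mk⇔
  (λ (bounds , no-cover) → bounds , λ above →
     [ no-cover , (λ maximal → maximal above) ]′ (cover-or-maximal t a))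
  (λ (bounds , maximal) → bounds , λ (c , a⋖c) → maximal (c , proj₁ a⋖c))

ups-wrap : ∀ X Y → ups (X ++ true ∷ Y ++ false ∷ []) ≡ suc (ups X + ups Y)
ups-wrap X Y = begin
  ups (X ++ true ∷ Y ++ false ∷ [])   ≡⟨ ups-++ X _ ⟩
  ups X + suc (ups (Y ++ false ∷ [])) ≡⟨ cong (λ u → ups X + suc u) (ups-++ Y _) ⟩
  ups X + suc (ups Y + 0)             ≡⟨ cong (λ u → ups X + suc u) (+-identityʳ _) ⟩
  ups X + suc (ups Y)                 ≡⟨ +-suc (ups X) (ups Y) ⟩
  suc (ups X + ups Y)                 ∎
  where open ≡-Reasoning

downs-wrap : ∀ X Y → downs (X ++ true ∷ Y ++ false ∷ []) ≡ suc (downs X + downs Y)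
downs-wrap X Y = begin
  downs (X ++ true ∷ Y ++ false ∷ [])   ≡⟨ downs-++ X _ ⟩
  downs X + downs (Y ++ false ∷ [])     ≡⟨ cong (downs X +_) (trans (downs-++ Y _) (+-comm _ 1)) ⟩
  downs X + suc (downs Y)               ≡⟨ +-suc (downs X) (downs Y) ⟩
  suc (downs X + downs Y)               ∎
  where open ≡-Reasoning

size-ups : ∀ {D t} → TreeOf D t → size t ≡ ups D
size-ups empty = refl
size-ups (split {D₁ = X} {Y} _ _ T₁ T₂) =
  trans (cong₂ (λ m n → suc (m + n)) (size-ups T₁) (size-ups T₂)) (sym (ups-wrap X Y))

edges-are-covers : ∀ {D t} → TreeOf D t → ∀ a b → Edge D a b ⇔ Covers t a b
edges-are-covers empty a b = mk⇔ (λ { (_ , _ , _ , (() , _) , _) }) (λ { (() , _) })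
edges-are-covers (split {D₁ = X} {Y} {t₁} {t₂} dyck-X dyck-Y T₁ T₂) a b = begin
  Edge (X ++ true ∷ Y ++ false ∷ []) a b                          ≈⟨ edge-split a b ⟩
  Glue (Edge X) (Edge Y) (Maximal (Edge X) k) k a b                ≈⟨ glue-cong IH₁ IH₂ maximal a b ⟩
  Glue (Covers t₁) (Covers t₂) (Maximal (InLeft t₁) k) k a b       ≡⟨ cong (λ k → Glue _ _ (Maximal _ k) k a b)
                                                                        (sym (size-ups T₁)) ⟩
  NodeGlue t₁ t₂ a b                                               ≈⟨ ⇔.sym (covers-node t₁ t₂ a b) ⟩
  Covers (node t₁ t₂) a b                                          ∎
  where
  open Decomposition X Y dyck-X dyck-Y using (k; edge-split)
  open SetoidReasoning (⇔.⇔-setoid 0ℓ)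
  IH₁ : ∀ a b → Edge X a b ⇔ Covers t₁ a b
  IH₁ = edges-are-covers T₁
  IH₂ : ∀ a b → Edge Y a b ⇔ Covers t₂ a b
  IH₂ = edges-are-covers T₂
  maximal : ∀ a → Maximal (Edge X) k a ⇔ Maximal (InLeft t₁) k a
  maximal a = ⇔.trans (maximal-cong IH₁ a) (maximal-covers t₁ k a)

dyck-wrap : ∀ {X Y} → IsDyckAny X → IsDyckAny Y → IsDyckAny (X ++ true ∷ Y ++ false ∷ [])
dyck-wrap {X} {Y} (_ , ups-X , downs-X , valid-X) (_ , ups-Y , downs-Y , valid-Y) =
  _ , refl , balanced , valid-++ X valid-X (valid-up Y0-valid) X-closes
  where
  X-closes : downs X ≡ ups X
  X-closes = trans downs-X (sym ups-X)
  Y-closes : 1 + downs Y ≡ 1 + ups Y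
  Y-closes = cong suc (trans downs-Y (sym ups-Y))
  balanced : downs (X ++ true ∷ Y ++ false ∷ []) ≡ ups (X ++ true ∷ Y ++ false ∷ [])
  balanced = begin
    downs (X ++ true ∷ Y ++ false ∷ []) ≡⟨ downs-wrap X Y ⟩
    suc (downs X + downs Y)             ≡⟨ cong₂ (λ m n → suc (m + n)) X-closes (suc-injective Y-closes) ⟩
    suc (ups X + ups Y)                 ≡⟨ sym (ups-wrap X Y) ⟩
    ups (X ++ true ∷ Y ++ false ∷ [])   ∎
    where open ≡-Reasoning
  Y0-valid : Valid 1 (Y ++ false ∷ [])
  Y0-valid = valid-++ Y (valid-raise valid-Y) (valid-down (valid-[] 0)) Y-closes

Parsed : List Bool → Set
Parsed P = IsDyckAny P × Σ Tree (TreeOf P)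

parsed-[] : Parsed []
parsed-[] = (0 , refl , refl , valid-[] 0) , leaf , empty

parsed-wrap : ∀ {P Q} → Parsed P → Parsed Q → Parsed (P ++ true ∷ Q ++ false ∷ [])
parsed-wrap (dyck-P , t , T) (dyck-Q , u , U) = dyck-wrap dyck-P dyck-Q , node t u , split dyck-P dyck-Q T U

-- Stack w h : w = P₀ 1 P₁ 1 ⋯ 1 Pₕ with parsed Dyck paths Pᵢ, i.e. a prefix of a Dyck
-- path at height h, cut at its last visits to the heights 0, …, h − 1.
data Stack : List Bool → ℕ → Set where
  bottom : ∀ {P} → Parsed P → Stack P 0
  _▹_ : ∀ {w h P} → Stack w h → Parsed P → Stack (w ++ true ∷ P) (suc h)

-- A down-step closes the last open up-step: ⋯ P 1 Q becomes ⋯ (P 1 Q 0).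
pop : ∀ {w h} → Stack w (suc h) → Stack (w ++ false ∷ []) h
pop (bottom {P} dP ▹ dQ) =
  subst (λ w → Stack w 0) (sym (++-assoc P (true ∷ _) (false ∷ []))) (bottom (parsed-wrap dP dQ))
pop ((_▹_ {w} {P = P} s dP) ▹ dQ) =
  subst (λ w → Stack w _)
    (sym (trans (++-assoc (w ++ true ∷ P) (true ∷ _) (false ∷ [])) (++-assoc w (true ∷ P) _)))
    (s ▹ parsed-wrap dP dQ)

parse : ∀ {w h} → Stack w h → ∀ v → Valid h v →
  ∃ λ h' → Stack (w ++ v) h' × h' + downs v ≡ h + ups v
parse {w} {h} s [] _ = h , subst (λ w → Stack w h) (sym (++-identityʳ w)) s , refl
parse {w} {h} s (true ∷ v) valid with h' , s' , e ← parse (s ▹ parsed-[]) v (valid-up⁻¹ valid) =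
  h' , subst (λ w → Stack w h') (++-assoc w (true ∷ []) v) s' , trans e (sym (+-suc h _))
parse {h = zero} s (false ∷ v) valid = contradiction valid no-descent-from-0
parse {w} {suc h} s (false ∷ v) valid with h' , s' , e ← parse (pop s) v (valid-down⁻¹ valid) =
  h' , subst (λ w → Stack w h') (++-assoc w (false ∷ []) v) s' , trans (+-suc h' _) (cong suc e)

-- Every Dyck path has a tree: parsing it leaves a stack of height 0.
tree-exists : ∀ n D → IsDyck n D → Σ Tree (TreeOf D)
tree-exists n D (ups-D , downs-D , valid) with h , s , e ← parse (bottom parsed-[]) D valid =
  bottom-tree (subst (Stack D) h≡0 s)
  where
  h≡0 : h ≡ 0
  h≡0 = +-cancelʳ-≡ (downs D) h 0 (trans e (trans ups-D (sym downs-D)))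
  bottom-tree : Stack D 0 → Σ Tree (TreeOf D)
  bottom-tree (bottom (_ , tree)) = tree

proposition2p17 : (n : ℕ) (D : List Bool) → IsDyck n D →
    (Σ Tree λ t → TreeOf D t) ×
    ((t : Tree) → TreeOf D t → (a b : ℕ) → Edge D a b ⇔ Covers t a b)
proposition2p17 n D dyck = tree-exists n D dyck , λ t T → edges-are-covers T
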